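{- Let $p$ be a prime, $l\in\mathbb{N}$ and $x\in\mathcal{X}_{p^l}$. Let $a=\lfloor p^lx\rfloor$ and suppose $\gcd(a,p)=1=\gcd(a+1,p)$ and $x=\frac{a}{p^l}\oplus\frac{a+1}{p^l}=\frac{2a+1}{2p^l}$. Then the $\mathcal{F}_{p^l}$-continued fraction expansion of $x$ with maximum $+1$ is not unique.
   Context: $\mathcal{X}_{p^l}=\{x/y: x,y\in\mathbb{Z},\ y>0,\ \gcd(x,y)=1,\ p^l\mid y\}\cup\{\infty\}$. For reduced $r_1/s_1,r_2/s_2$, $\frac{r_1}{s_1}\oplus\frac{r_2}{s_2}=\frac{r_1+r_2}{s_1+s_2}$. An $\mathcal{F}_{p^l}$-continued fraction is a finite expression $\frac{1}{0+}\,\frac{p^l}{b+}\,\frac{\epsilon_1}{a_1+}\cdots\frac{\epsilon_n}{a_n}$ ($n\ge0$) (or an infinite analogue), where $b\in\mathbb{Z}$ is coprime to $p$, $a_i\in\mathbb{N}$, $\epsilon_i\in\{1,-1\}$, and for all relevant $i\ge1$: $a_i+\epsilon_{i+1}\ge1$, $a_i+\epsilon_i\ge1$, $\gcd(p_i,q_i)=1$ where $p_i=a_ip_{i-1}+\epsilon_ip_{i-2}$, $q_i=a_iq_{i-1}+\epsilon_iq_{i-2}$, $(p_{ -1},q_{ -1})=(1,0)$, $(p_0,q_0)=(b,p^l)$. The $p_i/q_i$ are its convergents and the value of a finite one is its last convergent; an expansion of $x$ is one with value $x$. A finite expansion of $x\in\mathcal{X}_{p^l}$ whose last pair $(\epsilon_n,a_n)$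 is not $(1,1)$ is with maximum $+1$ if, among all $\mathcal{F}_{p^l}$-continued fraction expansions of $x$ not ending with $\frac11$, it has the largest number of indices $i\ge2$ with $\epsilon_i=+1$. -}

module Defs where

open import Data.Nat as ℕ using (ℕ; zero; suc; _^_; NonZero)
open import Data.Nat.Coprimality using (Coprime)
open import Data.Integer as ℤ using (ℤ; +_; ∣_∣; _+_; _*_)
open import Data.Integer.DivMod using (_/ℕ_)
open import Data.Sign using (Sign)
open import Data.List using (List; []; _∷_)
open import Data.Product using (_×_; _,_; Σ)
open import Data.Unit using (⊤)
open import Data.Empty using (⊥)
open import Relation.Binary.PropositionalEquality using (_≡_)

sgnℤ : Sign → ℤ
sgnℤ Sign.+ = + 1
sgnℤ Sign.- = ℤ.-[1+ 0 ]

-- An F_{p^l}-continued fraction  1/(0+) p^l/(b+) ε₁/(a₁+) ... εₙ/aₙ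
-- is recorded by b together with the list [(ε₁,a₁), …, (εₙ,aₙ)].
-- (p and l are parameters of the validity predicate.)
CF : Set
CF = ℤ × List (Sign × ℕ)

AddOk : ℕ → Sign → Set
AddOk a e = + 1 ℤ.≤ + a + sgnℤ e

NextOk : ℕ → List (Sign × ℕ) → Set
NextOk a [] = ⊤
NextOk a ((e' , _) ∷ _) = AddOk a e'

-- Conditions on the terms i ≥ 1, given (p_{i-2},q_{i-2}) and (p_{i-1},q_{i-1}):
-- a_i ∈ ℕ = {1,2,…}, a_i + ε_i ≥ 1, a_i + ε_{i+1} ≥ 1, gcd(p_i,q_i) = 1,
-- where p_i = a_i p_{i-1} + ε_i p_{i-2}, q_i = a_i q_{i-1} + ε_i q_{i-2}.
ValidTerms : (p₂ q₂ p₁ q₁ : ℤ) → List (Sign × ℕ) → Set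
ValidTerms p₂ q₂ p₁ q₁ [] = ⊤
ValidTerms p₂ q₂ p₁ q₁ ((e , a) ∷ rest) =
  1 ℕ.≤ a × AddOk a e × NextOk a rest × Coprime ∣ pᵢ ∣ ∣ qᵢ ∣
    × ValidTerms p₁ q₁ pᵢ qᵢ rest
  where
  pᵢ = + a * p₁ + sgnℤ e * p₂
  qᵢ = + a * q₁ + sgnℤ e * q₂

lastConvFrom : (p₂ q₂ p₁ q₁ : ℤ) → List (Sign × ℕ) → ℤ × ℤ
lastConvFrom p₂ q₂ p₁ q₁ [] = (p₁ , q₁)
lastConvFrom p₂ q₂ p₁ q₁ ((e , a) ∷ rest) =
  lastConvFrom p₁ q₁ (+ a * p₁ + sgnℤ e * p₂) (+ a * q₁ + sgnℤ e * q₂) rest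

-- (p_{-1},q_{-1}) = (1,0), (p_0,q_0) = (b, p^l)
IsFCF : (p l : ℕ) → CF → Set
IsFCF p l (b , ts) = Coprime ∣ b ∣ p × ValidTerms (+ 1) (+ 0) b (+ (p ^ l)) ts

value : (p l : ℕ) → CF → ℤ × ℤ
value p l (b , ts) = lastConvFrom (+ 1) (+ 0) b (+ (p ^ l)) ts

SameFrac : ℤ × ℤ → ℤ × ℤ → Set
SameFrac (r , s) (u , v) = r * v ≡ u * s

IsExpansionOf : (p l : ℕ) → CF → ℤ → ℕ → Set
IsExpansionOf p l E num den = IsFCF p l E × SameFrac (value p l E) (num , + den)

EndsWith11 : List (Sign × ℕ) → Set
EndsWith11 [] = ⊥
EndsWith11 (t ∷ []) = t ≡ (Sign.+ , 1)
EndsWith11 (_ ∷ t ∷ ts) = EndsWith11 (t ∷ ts)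

countPlus : List (Sign × ℕ) → ℕ
countPlus [] = 0
countPlus ((Sign.+ , _) ∷ ts) = suc (countPlus ts)
countPlus ((Sign.- , _) ∷ ts) = countPlus ts

-- number of indices i ≥ 2 with ε_i = +1
plusCount : CF → ℕ
plusCount (b , []) = 0
plusCount (b , (_ ∷ ts)) = countPlus ts

IsMaxPlusExpansion : (p l : ℕ) → CF → ℤ → ℕ → Set
IsMaxPlusExpansion p l E num den =
  IsExpansionOf p l E num den × (EndsWith11 (Data.Product.proj₂ E) → ⊥)
  × ((E' : CF) → IsExpansionOf p l E' num den → (EndsWith11 (Data.Product.proj₂ E') → ⊥)
       → plusCount E' ℕ.≤ plusCount E)

InX : (p l : ℕ) → ℤ → ℕ → Set
InX p l num den = 1 ℕ.≤ den × Coprime ∣ num ∣ den × (p ^ l) Data.Nat.Divisibility.∣ den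
  where import Data.Nat.Divisibility

_⊕_ : ℤ × ℤ → ℤ × ℤ → ℤ × ℤ
(r₁ , s₁) ⊕ (r₂ , s₂) = (r₁ + r₂ , s₁ + s₂)

floorMul : (p l : ℕ) (num : ℤ) (den : ℕ) .{{_ : NonZero den}} → ℤ
floorMul p l num den = (+ (p ^ l) * num) /ℕ den

-- The denominators q₀ = p^l ≤ q₁ ≤ q₂ ≤ … of an F_{p^l}-continued fraction never decrease, and
-- once there are two partial quotients (the last one not +1/1) the last denominator is at least
-- 3p^l: either q₁ ≥ 2p^l, or a₁ = 1 forces ε₂ = +1 and then q₂ ≥ 3p^l or q₂ = 2p^l with a further
-- term.  Since p^l divides the reduced denominator of x = (2a+1)/(2p^l) and 2a+1 is odd, that
-- denominator is exactly 2p^l.  So every expansion of x has one partial quotient, no index i ≥ 2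
-- carries +1, and every expansion is with maximum +1; two of them are 1/(0+) p^l/(a+) 1/2 and
-- 1/(0+) p^l/(a+1+) -1/2.
module Submission where

open import Defs
open import Data.Nat using (ℕ; suc; _^_; _≤_; _<_; _∸_; z≤n; s≤s; NonZero)
import Data.Nat as ℕ
import Data.Nat.Properties as ℕₚ
import Data.Nat.Tactic.RingSolver as ℕ-Solver
open import Data.Nat.Divisibility as ℕ∣ using (divides)
open import Data.Nat.Coprimality as Coprimality using (Coprime)
open import Data.Nat.Primality using (Prime; prime⇒nonZero; irreducible[2])
open import Data.Integer using (ℤ; +_; ∣_∣; _+_; _-_; _*_; +≤+)
import Data.Integer as ℤ
import Data.Integer.Properties as ℤₚ
import Data.Integer.Tactic.RingSolver as ℤ-Solver
open import Data.Sign using (Sign)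
open import Data.List using (List; []; _∷_)
open import Data.Product using (Σ; _×_; _,_; proj₁; proj₂)
open import Data.Sum using (inj₁; inj₂)
open import Data.Unit using (tt)
open import Data.Empty using (⊥-elim)
open import Function using (case_of_)
open import Relation.Nullary using (¬_)
open import Relation.Binary.PropositionalEquality
  using (_≡_; _≢_; refl; sym; trans; cong; cong₂; subst; module ≡-Reasoning)

-- q_i = a_i q_{i-1} + ε_i q_{i-2} on ℕ; the truncated subtraction is exact under the validity
-- conditions (nextDen-correct).
nextDen : Sign → ℕ → ℕ → ℕ → ℕ
nextDen Sign.+ a u v = a ℕ.* v ℕ.+ u
nextDen Sign.- a u v = a ℕ.* v ∸ u

nextDen-correct : ∀ e a {u v} → AddOk a e → u ≤ v →
                  + a * + v + sgnℤ e * + u ≡ + nextDen e a u v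
nextDen-correct Sign.+ a {u} {v} _ _ =
  cong₂ _+_ (sym (ℤₚ.pos-* a v)) (ℤₚ.*-identityˡ (+ u))
nextDen-correct Sign.- 0 ()
nextDen-correct Sign.- 1 (+≤+ ())
nextDen-correct Sign.- a@(suc (suc k)) {u} {v} _ u≤v = begin
  + a * + v + sgnℤ Sign.- * + u  ≡⟨ cong (_+_ (+ a * + v)) (ℤₚ.-1*i≡-i (+ u)) ⟩
  + a * + v - + u                ≡⟨ cong (_- + u) (ℤₚ.pos-* a v) ⟨
  + (a ℕ.* v) - + u              ≡⟨ ℤₚ.m-n≡m⊖n (a ℕ.* v) u ⟩
  (a ℕ.* v) ℤ.⊖ u                ≡⟨ ℤₚ.⊖-≥ (ℕₚ.≤-trans u≤v (ℕₚ.m≤m+n v _)) ⟩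
  + (a ℕ.* v ∸ u)                ∎
  where open ≡-Reasoning

nextDen-zero : ∀ e a v → nextDen e a 0 v ≡ a ℕ.* v
nextDen-zero Sign.+ a v = ℕₚ.+-identityʳ (a ℕ.* v)
nextDen-zero Sign.- a v = refl

nextDen-≥ : ∀ e a {u v} → 1 ≤ a → AddOk a e → u ≤ v → v ≤ nextDen e a u v
nextDen-≥ Sign.+ (suc k) {u} {v} _ _ _ =
  ℕₚ.≤-trans (ℕₚ.m≤m+n v (k ℕ.* v)) (ℕₚ.m≤m+n _ u)
nextDen-≥ Sign.- 0 _ ()
nextDen-≥ Sign.- 1 _ (+≤+ ())
nextDen-≥ Sign.- (suc (suc k)) {u} {v} _ _ u≤v = begin
  v                               ≤⟨ ℕₚ.m≤m+n v _ ⟩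
  v ℕ.+ (suc k ℕ.* v ∸ u)         ≡⟨ ℕₚ.+-∸-assoc v u≤sv ⟨
  suc (suc k) ℕ.* v ∸ u           ∎
  where
  open ℕₚ.≤-Reasoning
  u≤sv = ℕₚ.≤-trans u≤v (ℕₚ.m≤m+n v _)

nextDen-≥-sum : ∀ e a {u v} → 1 ≤ a → AddOk a e → 2 ℕ.* u ≤ v → u ℕ.+ v ≤ nextDen e a u v
nextDen-≥-sum Sign.+ (suc k) {u} {v} _ _ _ = begin
  u ℕ.+ v                   ≡⟨ ℕₚ.+-comm u v ⟩
  v ℕ.+ u                   ≤⟨ ℕₚ.+-monoˡ-≤ u (ℕₚ.m≤m+n v (k ℕ.* v)) ⟩
  suc k ℕ.* v ℕ.+ u         ∎
  where open ℕₚ.≤-Reasoning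
nextDen-≥-sum Sign.- 0 _ ()
nextDen-≥-sum Sign.- 1 _ (+≤+ ())
nextDen-≥-sum Sign.- a@(suc (suc k)) {u} {v} _ _ 2u≤v = ℕₚ.m+n≤o⇒m≤o∸n (u ℕ.+ v) (begin
  u ℕ.+ v ℕ.+ u             ≡⟨ ℕ-Solver.solve (u ∷ v ∷ []) ⟩
  2 ℕ.* u ℕ.+ v             ≤⟨ ℕₚ.+-monoˡ-≤ v 2u≤v ⟩
  v ℕ.+ v                   ≤⟨ ℕₚ.+-monoʳ-≤ v (ℕₚ.m≤m+n v _) ⟩
  a ℕ.* v                   ∎)
  where open ℕₚ.≤-Reasoning

lastDenFrom : (p₂ q₂ p₁ q₁ : ℤ) → List (Sign × ℕ) → ℤ
lastDenFrom p₂ q₂ p₁ q₁ ts = proj₂ (lastConvFrom p₂ q₂ p₁ q₁ ts)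

lastDen-step : ∀ {p₂ p₁ u v} e a ts → ValidTerms p₂ (+ u) p₁ (+ v) ((e , a) ∷ ts) → u ≤ v →
               Σ ℤ λ pᵢ → ValidTerms p₁ (+ v) pᵢ (+ nextDen e a u v) ts
                 × lastDenFrom p₂ (+ u) p₁ (+ v) ((e , a) ∷ ts)
                   ≡ lastDenFrom p₁ (+ v) pᵢ (+ nextDen e a u v) ts
lastDen-step {u = u} {v} e a ts (_ , ok , _ , _ , vt) u≤v
  with + a * + v + sgnℤ e * + u | nextDen-correct e a ok u≤v
... | _ | refl = _ , vt , refl

lastDen-≥ : ∀ {p₂ p₁ u v} ts → ValidTerms p₂ (+ u) p₁ (+ v) ts → u ≤ v →
            + v ℤ.≤ lastDenFrom p₂ (+ u) p₁ (+ v) ts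
lastDen-≥-next : ∀ {p₂ p₁ u v m} e a ts → ValidTerms p₂ (+ u) p₁ (+ v) ((e , a) ∷ ts) →
                 u ≤ v → m ≤ nextDen e a u v →
                 + m ℤ.≤ lastDenFrom p₂ (+ u) p₁ (+ v) ((e , a) ∷ ts)

lastDen-≥ [] _ _ = ℤₚ.≤-refl
lastDen-≥ ((e , a) ∷ ts) vt@(1≤a , ok , _) u≤v =
  lastDen-≥-next e a ts vt u≤v (nextDen-≥ e a 1≤a ok u≤v)

lastDen-≥-next e a ts vt@(1≤a , ok , _) u≤v m≤w with lastDen-step e a ts vt u≤v
... | _ , vt′ , eq = subst (_ ℤ.≤_) (sym eq)
  (ℤₚ.≤-trans (+≤+ m≤w) (lastDen-≥ ts vt′ (nextDen-≥ e a 1≤a ok u≤v)))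

lastDen-≥-from-double : ∀ {p₂ p₁ u v} e a ts → ValidTerms p₂ (+ u) p₁ (+ v) ((e , a) ∷ ts) →
                        2 ℕ.* u ≤ v → + (u ℕ.+ v) ℤ.≤ lastDenFrom p₂ (+ u) p₁ (+ v) ((e , a) ∷ ts)
lastDen-≥-from-double {u = u} e a ts vt@(1≤a , ok , _) 2u≤v =
  lastDen-≥-next e a ts vt (ℕₚ.≤-trans (ℕₚ.m≤m+n u _) 2u≤v) (nextDen-≥-sum e a 1≤a ok 2u≤v)

lastDen-≥-from-equal : ∀ {p₂ p₁ u v} a ts → v ≡ u →
                       ValidTerms p₂ (+ u) p₁ (+ v) ((Sign.+ , a) ∷ ts) →
                       ¬ EndsWith11 ((Sign.+ , a) ∷ ts) →
                       + (3 ℕ.* u) ℤ.≤ lastDenFrom p₂ (+ u) p₁ (+ v) ((Sign.+ , a) ∷ ts)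
lastDen-≥-from-equal 0 _ _ (() , _)
lastDen-≥-from-equal 1 [] _ _ ¬11 = ⊥-elim (¬11 refl)
lastDen-≥-from-equal {p₂} {p₁} {u} 1 ((e , a) ∷ ts) refl vt _
  with lastDen-step {p₂} {p₁} {u} {u} Sign.+ 1 ((e , a) ∷ ts) vt ℕₚ.≤-refl
... | p₁′ , vt′ , eq = subst (_ ℤ.≤_) (sym eq) (ℤₚ.≤-trans (+≤+ (ℕₚ.≤-reflexive 3u≡u+2u))
      (lastDen-≥-from-double {p₁} {p₁′} {u} e a ts vt′ (ℕₚ.≤-reflexive 2u≡1u+u)))
  where
  3u≡u+2u : 3 ℕ.* u ≡ u ℕ.+ (1 ℕ.* u ℕ.+ u)
  3u≡u+2u = ℕ-Solver.solve (u ∷ [])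
  2u≡1u+u : 2 ℕ.* u ≡ 1 ℕ.* u ℕ.+ u
  2u≡1u+u = ℕ-Solver.solve (u ∷ [])
lastDen-≥-from-equal {u = u} (suc (suc k)) ts refl vt _ =
  lastDen-≥-next Sign.+ _ ts vt ℕₚ.≤-refl (begin
    3 ℕ.* u                         ≤⟨ ℕₚ.m≤m+n (3 ℕ.* u) (k ℕ.* u) ⟩
    3 ℕ.* u ℕ.+ k ℕ.* u             ≡⟨ ℕ-Solver.solve (u ∷ k ∷ []) ⟩
    suc (suc k) ℕ.* u ℕ.+ u         ∎)
  where open ℕₚ.≤-Reasoning

-- q₁ = k q₀; when k = 1 the condition a₁ + ε₂ ≥ 1 forces ε₂ = +1.
lastDen-≥-from-multiple : ∀ {p₂ p₁ u v} k e a ts → v ≡ k ℕ.* u → 1 ≤ k → AddOk k e →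
                          ValidTerms p₂ (+ u) p₁ (+ v) ((e , a) ∷ ts) →
                          ¬ EndsWith11 ((e , a) ∷ ts) →
                          + (3 ℕ.* u) ℤ.≤ lastDenFrom p₂ (+ u) p₁ (+ v) ((e , a) ∷ ts)
lastDen-≥-from-multiple 1 Sign.- _ _ _ _ (+≤+ ())
lastDen-≥-from-multiple {u = u} 1 Sign.+ a ts v≡u _ _ vt ¬11 =
  lastDen-≥-from-equal a ts (trans v≡u (ℕₚ.*-identityˡ u)) vt ¬11
lastDen-≥-from-multiple {u = u} (suc (suc k)) e a ts refl _ _ vt _ =
  ℤₚ.≤-trans (+≤+ (ℕₚ.+-monoʳ-≤ u 2u≤v)) (lastDen-≥-from-double e a ts vt 2u≤v)
  where
  2u≤v : 2 ℕ.* u ≤ suc (suc k) ℕ.* u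
  2u≤v = ℕₚ.*-monoˡ-≤ u {2} {suc (suc k)} (s≤s (s≤s z≤n))

lastDen-≥-3pˡ : ∀ {b P} t₁ t₂ ts → ValidTerms (+ 1) (+ 0) b (+ P) (t₁ ∷ t₂ ∷ ts) →
                ¬ EndsWith11 (t₂ ∷ ts) →
                + (3 ℕ.* P) ℤ.≤ lastDenFrom (+ 1) (+ 0) b (+ P) (t₁ ∷ t₂ ∷ ts)
lastDen-≥-3pˡ {b} {P} (e₁ , a₁) (e₂ , a₂) ts vt@(1≤a₁ , _ , e₂-ok , _) ¬11
  with lastDen-step {+ 1} {b} {0} {P} e₁ a₁ ((e₂ , a₂) ∷ ts) vt z≤n
... | _ , vt₁ , eq = subst (_ ℤ.≤_) (sym eq)
  (lastDen-≥-from-multiple a₁ e₂ a₂ ts (nextDen-zero e₁ a₁ P) 1≤a₁ e₂-ok vt₁ ¬11)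

lastConv-coprime : ∀ {p₂ q₂ p₁ q₁} t ts → ValidTerms p₂ q₂ p₁ q₁ (t ∷ ts) →
                   let (pₙ , qₙ) = lastConvFrom p₂ q₂ p₁ q₁ (t ∷ ts) in Coprime ∣ pₙ ∣ ∣ qₙ ∣
lastConv-coprime t []        (_ , _ , _ , coprime , _) = coprime
lastConv-coprime _ (t ∷ ts) (_ , _ , _ , _ , vt)      = lastConv-coprime t ts vt

reduced-den-∣ : ∀ {r s u t} → Coprime ∣ r ∣ ∣ s ∣ → SameFrac (r , s) (u , t) → ∣ s ∣ ℕ∣.∣ ∣ t ∣
reduced-den-∣ {r} {s} {u} {t} coprime eq =
  Coprimality.coprime-divisor (Coprimality.sym coprime) (divides ∣ u ∣ (begin
    ∣ r ∣ ℕ.* ∣ t ∣   ≡⟨ ℤₚ.abs-* r t ⟨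
    ∣ r * t ∣         ≡⟨ cong ∣_∣ eq ⟩
    ∣ u * s ∣         ≡⟨ ℤₚ.abs-* u s ⟩
    ∣ u ∣ ℕ.* ∣ s ∣   ∎))
  where open ≡-Reasoning

+m≤i⇒m≤∣i∣ : ∀ {m i} → + m ℤ.≤ i → m ≤ ∣ i ∣
+m≤i⇒m≤∣i∣ (+≤+ m≤n) = m≤n

den<3pˡ⇒plusCount≡0 : ∀ {p l num den} .{{_ : NonZero den}} → den < 3 ℕ.* p ^ l →
                      ∀ E → IsExpansionOf p l E num den → ¬ EndsWith11 (proj₂ E) →
                      plusCount E ≡ 0
den<3pˡ⇒plusCount≡0 _ (_ , [])     _ _ = refl
den<3pˡ⇒plusCount≡0 _ (_ , _ ∷ []) _ _ = refl
den<3pˡ⇒plusCount≡0 {p} {l} {num} {den} den<3pˡ (b , t₁ ∷ t₂ ∷ ts) ((_ , vt) , x≡) ¬11 =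
  ⊥-elim (ℕₚ.<⇒≱ den<3pˡ (begin
    3 ℕ.* p ^ l   ≤⟨ +m≤i⇒m≤∣i∣ (lastDen-≥-3pˡ t₁ t₂ ts vt ¬11) ⟩
    ∣ qₙ ∣         ≤⟨ ℕ∣.∣⇒≤ (reduced-den-∣ {pₙ} {qₙ} {num} (lastConv-coprime t₁ (t₂ ∷ ts) vt) x≡) ⟩
    den           ∎))
  where
  open ℕₚ.≤-Reasoning
  pₙ qₙ : ℤ
  pₙ = proj₁ (value p l (b , t₁ ∷ t₂ ∷ ts))
  qₙ = proj₂ (value p l (b , t₁ ∷ t₂ ∷ ts))

den<3pˡ⇒isMaxPlus : ∀ {p l num den} .{{_ : NonZero den}} → den < 3 ℕ.* p ^ l →
                    ∀ E → IsExpansionOf p l E num den → ¬ EndsWith11 (proj₂ E) →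
                    IsMaxPlusExpansion p l E num den
den<3pˡ⇒isMaxPlus {p} {l} {num} {den} den<3pˡ E isExp ¬11 = isExp , ¬11 , λ E′ isExp′ ¬11′ →
  ℕₚ.≤-reflexive (trans (den<3pˡ⇒plusCount≡0 {p} {l} {num} {den} den<3pˡ E′ isExp′ ¬11′)
                        (sym (den<3pˡ⇒plusCount≡0 {p} {l} {num} {den} den<3pˡ E isExp ¬11)))

double≢odd : ∀ m a → m * + 2 ≢ + 2 * a + + 1
double≢odd m a eq =
  case ℕₚ.m*n≡1⇒n≡1 ∣ m - a ∣ 2 (trans (sym (ℤₚ.abs-* (m - a) (+ 2))) (cong ∣_∣ [m-a]*2≡1)) of λ ()
  where
  open ≡-Reasoning
  [m-a]*2≡1 : (m - a) * + 2 ≡ + 1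
  [m-a]*2≡1 = begin
    (m - a) * + 2               ≡⟨ ℤ-Solver.solve (m ∷ a ∷ []) ⟩
    m * + 2 - + 2 * a           ≡⟨ cong (_- + 2 * a) eq ⟩
    + 2 * a + + 1 - + 2 * a     ≡⟨ ℤ-Solver.solve (a ∷ []) ⟩
    + 1                         ∎

oddOver2P-lowestTerms : ∀ {P num den a} .{{_ : NonZero P}} → Coprime ∣ num ∣ den → P ℕ∣.∣ den →
                        SameFrac (num , + den) (+ 2 * a + + 1 , + 2 * + P) →
                        den ≡ 2 ℕ.* P × num ≡ + 2 * a + + 1
oddOver2P-lowestTerms {P} {num} {den} {a} coprime (divides j den≡jP) x≡ = den≡2P , num≡2a+1
  where
  open ≡-Reasoning
  den∣2P : den ℕ∣.∣ 2 ℕ.* P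
  den∣2P = subst (den ℕ∣.∣_) (ℤₚ.abs-* (+ 2) (+ P))
    (reduced-den-∣ {num} {+ den} {+ 2 * a + + 1} coprime x≡)
  j∣2 : j ℕ∣.∣ 2
  j∣2 = ℕ∣.*-cancelʳ-∣ {j} {2} P (subst (ℕ∣._∣ 2 ℕ.* P) den≡jP den∣2P)
  den≢P : den ≢ P
  den≢P den≡P = double≢odd num a (ℤₚ.*-cancelʳ-≡ (num * + 2) (+ 2 * a + + 1) (+ P) (begin
    num * + 2 * + P               ≡⟨ ℤₚ.*-assoc num (+ 2) (+ P) ⟩
    num * (+ 2 * + P)             ≡⟨ x≡ ⟩
    (+ 2 * a + + 1) * + den       ≡⟨ cong (λ d → (+ 2 * a + + 1) * + d) den≡P ⟩
    (+ 2 * a + + 1) * + P         ∎))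
  den≡2P : den ≡ 2 ℕ.* P
  den≡2P = case irreducible[2] j∣2 of λ where
    (inj₁ refl) → ⊥-elim (den≢P (trans den≡jP (ℕₚ.*-identityˡ P)))
    (inj₂ refl) → den≡jP
  num≡2a+1 : num ≡ + 2 * a + + 1
  num≡2a+1 = ℤₚ.*-cancelʳ-≡ num (+ 2 * a + + 1) (+ (2 ℕ.* P)) {{ℕₚ.m*n≢0 2 P}} (begin
    num * + (2 ℕ.* P)             ≡⟨ cong (num *_) (ℤₚ.pos-* 2 P) ⟩
    num * (+ 2 * + P)             ≡⟨ x≡ ⟩
    (+ 2 * a + + 1) * + den       ≡⟨ cong (λ d → (+ 2 * a + + 1) * + d) den≡2P ⟩
    (+ 2 * a + + 1) * + (2 ℕ.* P) ∎)

halfExpansion : ℤ → Sign → CF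
halfExpansion b e = b , (e , 2) ∷ []

+2*P+0≡+[2*P] : ∀ P → + 2 * + P + + 0 ≡ + (2 ℕ.* P)
+2*P+0≡+[2*P] P = trans (ℤₚ.+-identityʳ (+ 2 * + P)) (sym (ℤₚ.pos-* 2 P))

halfExpansion-isExpansion : ∀ {p l num den} b e → Coprime ∣ b ∣ p →
                            num ≡ + 2 * b + sgnℤ e → den ≡ 2 ℕ.* p ^ l → Coprime ∣ num ∣ den →
                            IsExpansionOf p l (halfExpansion b e) num den
halfExpansion-isExpansion {p} {l} b Sign.+ b-coprime refl refl coprime =
  (b-coprime , s≤s z≤n , +≤+ (s≤s z≤n) , tt , subst (Coprime _) (cong ∣_∣ (sym 2P≡)) coprime , tt) ,
  cong (_*_ (+ 2 * b + + 1)) (sym 2P≡)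
  where 2P≡ = +2*P+0≡+[2*P] (p ^ l)
halfExpansion-isExpansion {p} {l} b Sign.- b-coprime refl refl coprime =
  (b-coprime , s≤s z≤n , +≤+ (s≤s z≤n) , tt , subst (Coprime _) (cong ∣_∣ (sym 2P≡)) coprime , tt) ,
  cong (_*_ (+ 2 * b - + 1)) (sym 2P≡)
  where 2P≡ = +2*P+0≡+[2*P] (p ^ l)

2[a+1]-1≡2a+1 : ∀ a → + 2 * (a + + 1) - + 1 ≡ + 2 * a + + 1
2[a+1]-1≡2a+1 = ℤ-Solver.solve-∀

mainTheorem4 : (p l : ℕ) → Prime p → 1 ≤ l
    → (num : ℤ) (den : ℕ) .{{_ : NonZero den}} → InX p l num den
    → let a = floorMul p l num den in
      Coprime ∣ a ∣ p → Coprime ∣ a + + 1 ∣ p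
    → SameFrac (num , + den) ((a , + (p ^ l)) ⊕ (a + + 1 , + (p ^ l)))
    → SameFrac (num , + den) (+ 2 * a + + 1 , + 2 * + (p ^ l))
    → Σ CF λ E₁ → Σ CF λ E₂ →
        IsMaxPlusExpansion p l E₁ num den × IsMaxPlusExpansion p l E₂ num den
        × E₁ ≢ E₂
mainTheorem4 p l p-prime _ num den (_ , coprime , pˡ∣den) a-coprime a+1-coprime _ x≡ =
  E₁ , E₂ , isMaxPlus E₁ E₁-isExp (λ ()) , isMaxPlus E₂ E₂-isExp (λ ()) , λ ()
  where
  instance
    pˡ≢0 : NonZero (p ^ l)
    pˡ≢0 = ℕₚ.m^n≢0 p l {{prime⇒nonZero p-prime}}
  a = floorMul p l num den
  den≡2pˡ : den ≡ 2 ℕ.* p ^ l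
  den≡2pˡ = proj₁ (oddOver2P-lowestTerms {p ^ l} {num} {den} {a} coprime pˡ∣den x≡)
  num≡2a+1 : num ≡ + 2 * a + + 1
  num≡2a+1 = proj₂ (oddOver2P-lowestTerms {p ^ l} {num} {den} {a} coprime pˡ∣den x≡)
  isMaxPlus : ∀ E → IsExpansionOf p l E num den → ¬ EndsWith11 (proj₂ E) →
              IsMaxPlusExpansion p l E num den
  isMaxPlus = den<3pˡ⇒isMaxPlus {p} {l} {num} {den}
    (subst (_< 3 ℕ.* p ^ l) (sym den≡2pˡ) (ℕₚ.*-monoˡ-< (p ^ l) (ℕₚ.n<1+n 2)))
  E₁ E₂ : CF
  E₁ = halfExpansion a Sign.+
  E₂ = halfExpansion (a + + 1) Sign.-
  E₁-isExp : IsExpansionOf p l E₁ num den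
  E₁-isExp = halfExpansion-isExpansion {p} {l} a Sign.+ a-coprime num≡2a+1 den≡2pˡ coprime
  E₂-isExp : IsExpansionOf p l E₂ num den
  E₂-isExp = halfExpansion-isExpansion {p} {l} (a + + 1) Sign.- a+1-coprime
    (trans num≡2a+1 (sym (2[a+1]-1≡2a+1 a))) den≡2pˡ coprime
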